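{- Let $r\ge1$ and let $M_1,\dots,M_r,L$ be integers. For nonnegative integers $\nu_1,\dots,\nu_r$ write $N=\nu_1+\cdots+\nu_r$. Then, as formal power series in $a_1,\dots,a_r,c$, \[ \sum_{\nu_1,\dots,\nu_r,k\ge0}a_1^{\nu_1}\cdots a_r^{\nu_r}c^kq^{2(T_{\nu_1}+\cdots+T_{\nu_r})+T_k+kN}\frac{(q^{L-N-k+1};q)_k}{(q;q)_{N+k}}{N\brack \nu_1,\dots,\nu_r}_{q^2}{N+k\brack N,k}_q\prod_{i=1}^r(q^{2M_i-2\nu_i+2};q^2)_{\nu_i} \] \[ =\sum_{\nu_1,\dots,\nu_r\ge0}a_1^{\nu_1}\cdots a_r^{\nu_r}q^{2(T_{\nu_1}+\cdots+T_{\nu_r})}{M_1\brack\nu_1}_{q^2}\cdots{M_r\brack\nu_r}_{q^2}(-q;q)_N(-cq^{N+1};q)_{L-N}. \]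
   Context: $T_k=k(k+1)/2$. For any integer $n$: $(x;p)_n=\prod_{j=0}^{n-1}(1-xp^j)$ if $n\ge0$, and $(x;p)_n=1/\prod_{j=1}^{ -n}(1-xp^{ -j})$ if $n<0$. For any integer $n$ and integer $k\ge0$, ${n\brack k}_p=\frac{(p^{n-k+1};p)_k}{(p;p)_k}$. $q$-multinomial coefficients: ${N\brack \nu_1,\dots,\nu_r}_{q^2}=\frac{(q^2;q^2)_N}{\prod_i(q^2;q^2)_{\nu_i}}$ and ${N+k\brack N,k}_q=\frac{(q;q)_{N+k}}{(q;q)_N(q;q)_k}$. -}

module Defs where

open import Data.Nat as ℕ using (ℕ; zero; suc; _∸_)
open import Data.Integer as ℤ using (ℤ; +_; -[1+_])
open import Data.Fin using (Fin; zero; suc)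
open import Algebra.Bundles using (CommutativeRing)

T : ℕ → ℕ
T zero    = zero
T (suc k) = suc k ℕ.+ T k

sumFin : ∀ {r} → (Fin r → ℕ) → ℕ
sumFin {zero}  f = 0
sumFin {suc r} f = f zero ℕ.+ sumFin (λ i → f (suc i))

module _ {c ℓ} (R : CommutativeRing c ℓ) where
  open CommutativeRing R hiding (zero)

  _−_ : Carrier → Carrier → Carrier
  x − y = x + (- y)

  pow : Carrier → ℕ → Carrier
  pow x zero    = 1#
  pow x (suc n) = x * pow x n

  -- integer powers of b, given an inverse bi of b
  zpow : Carrier → Carrier → ℤ → Carrier
  zpow b bi (+ n)      = pow b n
  zpow b bi -[1+ n ]   = pow bi (suc n)

  prod : ℕ → (ℕ → Carrier) → Carrier
  prod zero    f = 1#
  prod (suc n) f = prod n f * f n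

  prodFin : ∀ {r} → (Fin r → Carrier) → Carrier
  prodFin {zero}  f = 1#
  prodFin {suc r} f = f zero * prodFin (λ i → f (suc i))

  poch : Carrier → Carrier → ℕ → Carrier
  poch x p n = prod n (λ j → 1# − (x * pow p j))

  -- 1/(p;p)_n, given ι j = 1/(1 - p^{j+1})
  pochInv : (ℕ → Carrier) → ℕ → Carrier
  pochInv ι n = prod n ι

  qbin : Carrier → Carrier → (ℕ → Carrier) → ℤ → ℕ → Carrier
  qbin p pi ι n k = poch (zpow p pi (n ℤ.- + k ℤ.+ + 1)) p k * pochInv ι k

  -- formal power series in the variable c with coefficients in R
  Series : Set c
  Series = ℕ → Carrier

  sumTo : ℕ → (ℕ → Carrier) → Carrier
  sumTo zero    f = 0#
  sumTo (suc n) f = sumTo n f + f n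

  _⊛_ : Series → Series → Series
  (f ⊛ g) n = sumTo (suc n) (λ i → f i * g (n ∸ i))

  oneS : Series
  oneS zero    = 1#
  oneS (suc _) = 0#

  linS : Carrier → Series
  linS y zero          = 1#
  linS y (suc zero)    = - y
  linS y (suc (suc _)) = 0#

  geomS : Carrier → Series
  geomS y i = pow y i

  prodS : ℕ → (ℕ → Series) → Series
  prodS zero    f = oneS
  prodS (suc n) f = prodS n f ⊛ f n

  -- (x c; p)_n as a power series in c, for any integer n
  -- n ≥ 0 : ∏_{j=0}^{n-1} (1 - x p^j c)
  -- n < 0 : 1/∏_{j=1}^{-n} (1 - x p^{-j} c) = ∏_{j=1}^{-n} 1/(1 - x p^{-j} c)
  cpoch : Carrier → Carrier → Carrier → ℤ → Series
  cpoch x p pi (+ n)    = prodS n (λ j → linS (x * pow p j))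
  cpoch x p pi -[1+ m ] = prodS (suc m) (λ j → geomS (x * pow pi (suc j)))

  -- Data: q, an inverse qi of q, and inv n = 1/(1 - q^{n+1}).
  module Thm13 (q qi : Carrier) (inv : ℕ → Carrier) {r : ℕ}
               (M : Fin r → ℤ) (L : ℤ) where
    p2 p2i : Carrier
    p2  = q * q
    p2i = qi * qi
    -- 1/(1 - (q^2)^{j+1}) = 1/(1 - q^{2j+2})
    ι2 : ℕ → Carrier
    ι2 j = inv (suc (2 ℕ.* j))

    -- coefficient of a_1^{ν_1}…a_r^{ν_r} c^k on the left-hand side
    lhsCoeff : (Fin r → ℕ) → ℕ → Carrier
    lhsCoeff ν k =
      pow q (2 ℕ.* sumFin (λ i → T (ν i)) ℕ.+ T k ℕ.+ k ℕ.* N)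
      * poch (zpow q qi (L ℤ.- + N ℤ.- + k ℤ.+ + 1)) q k
      * pochInv inv (N ℕ.+ k)
      * (poch p2 p2 N * prodFin (λ i → pochInv ι2 (ν i)))
      * (poch q q (N ℕ.+ k) * pochInv inv N * pochInv inv k)
      * prodFin (λ i → poch (zpow q qi (+ 2 ℤ.* M i ℤ.- + (2 ℕ.* ν i) ℤ.+ + 2)) p2 (ν i))
      where N = sumFin ν

    -- right-hand side: Σ_ν a^ν (term ν) (-c q^{N+1}; q)_{L-N}, as a series in c
    rhsSeries : (Fin r → ℕ) → Series
    rhsSeries ν k =
      pow q (2 ℕ.* sumFin (λ i → T (ν i)))
      * prodFin (λ i → qbin p2 p2i ι2 (M i) (ν i))
      * poch (- q) q N
      * cpoch (- pow q (suc N)) q qi (L ℤ.- + N) k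
      where N = sumFin ν

module Submission where

-- For every integer n, the coefficient of c^k in (x c; q)_n is (-x)^k q^(T_k - k) [n k]_q
-- (q-binomial theorem). Both sides obey the same recursion in n, coming from
-- (x c; q)_(n+1) = (x c; q)_n (1 - x q^n c) and read as a division when n < 0, and the
-- recursion on the q-binomial side is q-Pascal [n+1 k+1] = [n k+1] + q^(n-k) [n k].
-- Applied with x = -q^(N+1), it turns the right-hand side into the left-hand side once
-- (q²;q²)_N / (q;q)_N = (-q;q)_N is used, (q;q)_(N+k) cancels against its inverse, and
-- q^(2M-2ν+2) = (q²)^(M-ν+1) identifies the q²-binomials.

open import Defs
open import Data.Nat using (ℕ; suc; _≤_)
open import Data.Integer using (ℤ)
open import Data.Fin using (Fin)
open import Algebra.Bundles using (CommutativeRing)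

open import Data.Nat as ℕ using (zero; _<_; s≤s)
import Data.Nat.Properties as ℕP
open import Data.Integer as ℤ using (+_; -[1+_])
import Data.Integer.Properties as ℤP
open import Data.Integer.Tactic.RingSolver using (solve-∀)
import Data.Fin as Fin
import Algebra.Solver.Ring.NaturalCoefficients.Default as NaturalCoefficientsSolver
import Relation.Binary.Reasoning.Setoid as SetoidReasoning
open import Relation.Binary.PropositionalEquality as ≡ using (_≡_)

module _ {c ℓ} (R : CommutativeRing c ℓ) where
  open CommutativeRing R hiding (zero)
  open import Algebra.Properties.Ring ring
    using (-‿distribˡ-*; -‿distribʳ-*; -‿involutive; \\-leftDividesʳ; //-rightDividesʳ; x[y-z]≈xy-xz; [y-z]x≈yx-zx)
  open import Algebra.Properties.CommutativeSemigroup *-commutativeSemigroup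
    using (interchange; x∙yz≈y∙xz; x∙yz≈xz∙y; xy∙z≈xz∙y; xy∙z≈y∙xz)
  open NaturalCoefficientsSolver commutativeSemiring using (solve; _:=_; _:*_; _:+_)
  open SetoidReasoning setoid

  pow-homo-* : ∀ x m n → pow R x (m ℕ.+ n) ≈ pow R x m * pow R x n
  pow-homo-* x zero    n = sym (*-identityˡ _)
  pow-homo-* x (suc m) n = trans (*-congˡ (pow-homo-* x m n)) (sym (*-assoc _ _ _))

  pow-assocʳ : ∀ x m n → pow R (pow R x m) n ≈ pow R x (n ℕ.* m)
  pow-assocʳ x m zero    = refl
  pow-assocʳ x m (suc n) = trans (*-congˡ (pow-assocʳ x m n)) (sym (pow-homo-* x m (n ℕ.* m)))

  pow-distrib-* : ∀ x y n → pow R (x * y) n ≈ pow R x n * pow R y n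
  pow-distrib-* x y zero    = sym (*-identityˡ 1#)
  pow-distrib-* x y (suc n) = trans (*-congˡ (pow-distrib-* x y n)) (interchange x y _ _)

  prod-cong : ∀ n {f g : ℕ → Carrier} → (∀ j → f j ≈ g j) → prod R n f ≈ prod R n g
  prod-cong zero    f≈g = refl
  prod-cong (suc n) f≈g = *-cong (prod-cong n f≈g) (f≈g n)

  prod-distrib-* : ∀ n (f g : ℕ → Carrier) → prod R n (λ j → f j * g j) ≈ prod R n f * prod R n g
  prod-distrib-* zero    f g = sym (*-identityˡ 1#)
  prod-distrib-* (suc n) f g = trans (*-congʳ (prod-distrib-* n f g)) (interchange _ _ (f n) (g n))

  prod-≈1 : ∀ n {f : ℕ → Carrier} → (∀ j → f j ≈ 1#) → prod R n f ≈ 1#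
  prod-≈1 zero    f≈1 = refl
  prod-≈1 (suc n) f≈1 = trans (*-cong (prod-≈1 n f≈1) (f≈1 n)) (*-identityˡ 1#)

  prodFin-cong : ∀ {r} {f g : Fin r → Carrier} → (∀ i → f i ≈ g i) → prodFin R f ≈ prodFin R g
  prodFin-cong {zero}  f≈g = refl
  prodFin-cong {suc r} f≈g = *-cong (f≈g Fin.zero) (prodFin-cong (λ i → f≈g (Fin.suc i)))

  prodFin-distrib-* : ∀ {r} (f g : Fin r → Carrier) →
                      prodFin R (λ i → f i * g i) ≈ prodFin R f * prodFin R g
  prodFin-distrib-* {zero}  f g = sym (*-identityˡ 1#)
  prodFin-distrib-* {suc r} f g =
    trans (*-congˡ (prodFin-distrib-* (λ i → f (Fin.suc i)) (λ i → g (Fin.suc i))))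
          (interchange (f Fin.zero) (g Fin.zero) _ _)

  poch-congˡ : ∀ {x y} p n → x ≈ y → poch R x p n ≈ poch R y p n
  poch-congˡ p n x≈y = prod-cong n (λ j → +-congˡ (-‿cong (*-congʳ x≈y)))

  poch-suc-head : ∀ x p n → poch R x p (suc n) ≈ (1# - x) * poch R (x * p) p n
  poch-suc-head x p zero = begin
    1# * (1# - x * 1#) ≈⟨ *-identityˡ _ ⟩
    1# - x * 1#        ≈⟨ +-congˡ (-‿cong (*-identityʳ x)) ⟩
    1# - x             ≈⟨ *-identityʳ _ ⟨
    (1# - x) * 1#      ∎
  poch-suc-head x p (suc n) = begin
    poch R x p (suc n) * (1# - x * (p * pow R p n))
      ≈⟨ *-cong (poch-suc-head x p n) (+-congˡ (-‿cong (sym (*-assoc x p _)))) ⟩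
    ((1# - x) * poch R (x * p) p n) * (1# - (x * p) * pow R p n)
      ≈⟨ *-assoc _ _ _ ⟩
    (1# - x) * poch R (x * p) p (suc n) ∎

  [x-y]+[y-z]≈x-z : ∀ x y z → (x - y) + (y - z) ≈ x - z
  [x-y]+[y-z]≈x-z x y z = trans (+-assoc x (- y) (y - z)) (+-congˡ (\\-leftDividesʳ y (- z)))

  [1-x][1+x]≈1-x² : ∀ x → (1# - x) * (1# - - x) ≈ 1# - x * x
  [1-x][1+x]≈1-x² x = begin
    (1# - x) * (1# - - x)           ≈⟨ *-congˡ (+-congˡ (-‿involutive x)) ⟩
    (1# - x) * (1# + x)             ≈⟨ distribˡ _ 1# x ⟩
    (1# - x) * 1# + (1# - x) * x    ≈⟨ +-cong (*-identityʳ _) ([y-z]x≈yx-zx x 1# x) ⟩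
    (1# - x) + (1# * x - x * x)     ≈⟨ +-congˡ (+-congʳ (*-identityˡ x)) ⟩
    (1# - x) + (x - x * x)          ≈⟨ [x-y]+[y-z]≈x-z 1# x (x * x) ⟩
    1# - x * x                      ∎

  [1-xy]z≈[1-x]z+x : ∀ x y z → (1# - y) * z ≈ 1# → (1# - x * y) * z ≈ (1# - x) * z + x
  [1-xy]z≈[1-x]z+x x y z [1-y]z≈1 = begin
    (1# - x * y) * z                ≈⟨ *-congʳ ([x-y]+[y-z]≈x-z 1# x (x * y)) ⟨
    ((1# - x) + (x - x * y)) * z    ≈⟨ distribʳ z _ _ ⟩
    (1# - x) * z + (x - x * y) * z  ≈⟨ +-congˡ (*-congʳ x[1-y]≈x-xy) ⟨
    (1# - x) * z + x * (1# - y) * z ≈⟨ +-congˡ (*-assoc x _ z) ⟩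
    (1# - x) * z + x * ((1# - y) * z) ≈⟨ +-congˡ (*-congˡ [1-y]z≈1) ⟩
    (1# - x) * z + x * 1#           ≈⟨ +-congˡ (*-identityʳ x) ⟩
    (1# - x) * z + x                ∎
    where
    x[1-y]≈x-xy : x * (1# - y) ≈ x - x * y
    x[1-y]≈x-xy = trans (x[y-z]≈xy-xz x 1# y) (+-congʳ (*-identityʳ x))

  sumTo-cong : ∀ n {f g : ℕ → Carrier} → (∀ i → i < n → f i ≈ g i) → sumTo R n f ≈ sumTo R n g
  sumTo-cong zero    f≈g = refl
  sumTo-cong (suc n) f≈g =
    +-cong (sumTo-cong n (λ i i<n → f≈g i (ℕP.m<n⇒m<1+n i<n))) (f≈g n (ℕP.n<1+n n))

  sumTo-≈0 : ∀ n {f : ℕ → Carrier} → (∀ i → i < n → f i ≈ 0#) → sumTo R n f ≈ 0#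
  sumTo-≈0 zero    f≈0 = refl
  sumTo-≈0 (suc n) f≈0 =
    trans (+-cong (sumTo-≈0 n (λ i i<n → f≈0 i (ℕP.m<n⇒m<1+n i<n))) (f≈0 n (ℕP.n<1+n n)))
          (+-identityˡ 0#)

  *-distribˡ-sumTo : ∀ x n (f : ℕ → Carrier) → x * sumTo R n f ≈ sumTo R n (λ i → x * f i)
  *-distribˡ-sumTo x zero    f = zeroʳ x
  *-distribˡ-sumTo x (suc n) f = trans (distribˡ x _ _) (+-congʳ (*-distribˡ-sumTo x n f))

  ⊛-zero : ∀ f g → _⊛_ R f g 0 ≈ f 0 * g 0
  ⊛-zero f g = +-identityˡ _

  linS-vanishes : ∀ y {i k} → i < k → linS R y (suc k ℕ.∸ i) ≡ 0#
  linS-vanishes y {zero}  {suc k} _         = ≡.refl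
  linS-vanishes y {suc i} {suc k} (s≤s i<k) = linS-vanishes y i<k

  ⊛-linS-suc : ∀ g y k → _⊛_ R g (linS R y) (suc k) ≈ g (suc k) - y * g k
  ⊛-linS-suc g y k = begin
    (sumTo R k F + g k * linS R y (suc k ℕ.∸ k)) + g (suc k) * linS R y (k ℕ.∸ k)
      ≈⟨ +-cong (+-cong (sumTo-≈0 k F≈0) (*-congˡ (reflexive (≡.cong (linS R y) (ℕP.m+n∸n≡m 1 k)))))
                (*-congˡ (reflexive (≡.cong (linS R y) (ℕP.n∸n≡0 k)))) ⟩
    (0# + g k * - y) + g (suc k) * 1#
      ≈⟨ +-cong (+-identityˡ _) (*-identityʳ _) ⟩
    g k * - y + g (suc k)
      ≈⟨ +-comm _ _ ⟩
    g (suc k) + g k * - y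
      ≈⟨ +-congˡ (trans (-‿cong (*-comm y (g k))) (-‿distribʳ-* (g k) y)) ⟨
    g (suc k) - y * g k ∎
    where
    F : ℕ → Carrier
    F i = g i * linS R y (suc k ℕ.∸ i)
    F≈0 : ∀ i → i < k → F i ≈ 0#
    F≈0 i i<k = trans (*-congˡ (reflexive (linS-vanishes y i<k))) (zeroʳ (g i))

  ⊛-geomS-suc : ∀ g y k → _⊛_ R g (geomS R y) (suc k) ≈ g (suc k) + y * _⊛_ R g (geomS R y) k
  ⊛-geomS-suc g y k = begin
    sumTo R (suc k) F + g (suc k) * pow R y (k ℕ.∸ k)
      ≈⟨ +-cong (sumTo-cong (suc k) F≈yG) (*-congˡ (reflexive (≡.cong (pow R y) (ℕP.n∸n≡0 k)))) ⟩
    sumTo R (suc k) (λ i → y * G i) + g (suc k) * 1#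
      ≈⟨ +-cong (*-distribˡ-sumTo y (suc k) G) (sym (*-identityʳ _)) ⟨
    y * sumTo R (suc k) G + g (suc k)
      ≈⟨ +-comm _ _ ⟩
    g (suc k) + y * _⊛_ R g (geomS R y) k ∎
    where
    F G : ℕ → Carrier
    F i = g i * pow R y (suc k ℕ.∸ i)
    G i = g i * pow R y (k ℕ.∸ i)
    F≈yG : ∀ i → i < suc k → F i ≈ y * G i
    F≈yG i (s≤s i≤k) = trans (*-congˡ (reflexive (≡.cong (pow R y) (ℕP.+-∸-assoc 1 i≤k))))
                             (x∙yz≈y∙xz (g i) y _)

  module IntegerPowers (q qi : Carrier) (q*qi≈1 : q * qi ≈ 1#) where

    private
      Z : ℤ → Carrier
      Z = zpow R q qi

    qi*x*q≈x : ∀ x → (qi * x) * q ≈ x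
    qi*x*q≈x x = trans (xy∙z≈xz∙y qi x q) (trans (*-congʳ (trans (*-comm qi q) q*qi≈1)) (*-identityˡ x))

    zpow-suc : ∀ z → Z (z ℤ.+ + 1) ≈ Z z * q
    zpow-suc (+ n)           = trans (reflexive (≡.cong (pow R q) (ℕP.+-comm n 1))) (*-comm q _)
    zpow-suc -[1+ zero ]     = sym (qi*x*q≈x 1#)
    zpow-suc -[1+ suc m ]    = sym (qi*x*q≈x (pow R qi (suc m)))

    zpow-pred : ∀ z → Z (z ℤ.+ -[1+ 0 ]) ≈ Z z * qi
    zpow-pred z = begin
      Z z′                       ≈⟨ *-identityʳ _ ⟨
      Z z′ * 1#                  ≈⟨ *-congˡ q*qi≈1 ⟨
      Z z′ * (q * qi)            ≈⟨ *-assoc _ q qi ⟨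
      (Z z′ * q) * qi            ≈⟨ *-congʳ (zpow-suc z′) ⟨
      Z (z′ ℤ.+ + 1) * qi        ≡⟨ ≡.cong (λ w → Z w * qi) (z-1+1≡z z) ⟩
      Z z * qi                   ∎
      where
      z′ : ℤ
      z′ = z ℤ.+ -[1+ 0 ]
      z-1+1≡z : ∀ z → (z ℤ.+ -[1+ 0 ]) ℤ.+ + 1 ≡ z
      z-1+1≡z = solve-∀

    zpow-homo-* : ∀ m n → Z m * Z n ≈ Z (m ℤ.+ n)
    zpow-homo-* m (+ zero) = trans (*-identityʳ _) (reflexive (≡.cong Z (≡.sym (ℤP.+-identityʳ m))))
    zpow-homo-* m (+ suc n) = begin
      Z m * (q * pow R q n)    ≈⟨ x∙yz≈xz∙y (Z m) q _ ⟩
      (Z m * Z (+ n)) * q      ≈⟨ *-congʳ (zpow-homo-* m (+ n)) ⟩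
      Z (m ℤ.+ + n) * q        ≈⟨ zpow-suc (m ℤ.+ + n) ⟨
      Z (m ℤ.+ + n ℤ.+ + 1)    ≡⟨ ≡.cong Z (m+n+1≡m+[1+n] m n) ⟩
      Z (m ℤ.+ + suc n)        ∎
      where
      m+n+1≡m+[1+n] : ∀ m n → m ℤ.+ + n ℤ.+ + 1 ≡ m ℤ.+ + suc n
      m+n+1≡m+[1+n] m n = ≡.trans (ℤP.+-assoc m (+ n) (+ 1)) (≡.cong (λ t → m ℤ.+ + t) (ℕP.+-comm n 1))
    zpow-homo-* m -[1+ zero ] = trans (*-congˡ (*-identityʳ qi)) (sym (zpow-pred m))
    zpow-homo-* m -[1+ suc n ] = begin
      Z m * (qi * pow R qi (suc n))       ≈⟨ x∙yz≈xz∙y (Z m) qi _ ⟩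
      (Z m * Z -[1+ n ]) * qi             ≈⟨ *-congʳ (zpow-homo-* m -[1+ n ]) ⟩
      Z (m ℤ.+ -[1+ n ]) * qi             ≈⟨ zpow-pred (m ℤ.+ -[1+ n ]) ⟨
      Z (m ℤ.+ -[1+ n ] ℤ.+ -[1+ 0 ])     ≡⟨ ≡.cong Z (m-[1+n]-1≡m-[2+n] m n) ⟩
      Z (m ℤ.+ -[1+ suc n ])              ∎
      where
      m-[1+n]-1≡m-[2+n] : ∀ m n → m ℤ.+ -[1+ n ] ℤ.+ -[1+ 0 ] ≡ m ℤ.+ -[1+ suc n ]
      m-[1+n]-1≡m-[2+n] m n = ≡.trans (ℤP.+-assoc m -[1+ n ] -[1+ 0 ])
                         (≡.cong (λ t → m ℤ.+ -[1+ suc t ]) (ℕP.+-identityʳ n))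

    zpow-double : ∀ z → Z (+ 2 ℤ.* z) ≈ zpow R (q * q) (qi * qi) z
    zpow-double z = begin
      Z (+ 2 ℤ.* z)   ≡⟨ ≡.cong Z (double z) ⟩
      Z (z ℤ.+ z)     ≈⟨ zpow-homo-* z z ⟨
      Z z * Z z       ≈⟨ square z ⟨
      zpow R (q * q) (qi * qi) z ∎
      where
      double : ∀ z → + 2 ℤ.* z ≡ z ℤ.+ z
      double = solve-∀
      square : ∀ z → zpow R (q * q) (qi * qi) z ≈ Z z * Z z
      square (+ n)     = pow-distrib-* q q n
      square -[1+ m ]  = pow-distrib-* qi qi (suc m)

    qbin-square : ∀ ι m v → qbin R (q * q) (qi * qi) ι m v ≈
                  poch R (Z (+ 2 ℤ.* m ℤ.- + (2 ℕ.* v) ℤ.+ + 2)) (q * q) v * pochInv R ι v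
    qbin-square ι m v = *-congʳ (poch-congˡ (q * q) v (begin
      zpow R (q * q) (qi * qi) (m ℤ.- + v ℤ.+ + 1)   ≈⟨ zpow-double (m ℤ.- + v ℤ.+ + 1) ⟨
      Z (+ 2 ℤ.* (m ℤ.- + v ℤ.+ + 1))                ≡⟨ ≡.cong Z (exponent m v) ⟨
      Z (+ 2 ℤ.* m ℤ.- + (2 ℕ.* v) ℤ.+ + 2)          ∎))
      where
      double-distrib : ∀ m v → + 2 ℤ.* m ℤ.- + 2 ℤ.* v ℤ.+ + 2 ≡ + 2 ℤ.* (m ℤ.- v ℤ.+ + 1)
      double-distrib = solve-∀
      exponent : ∀ m v → + 2 ℤ.* m ℤ.- + (2 ℕ.* v) ℤ.+ + 2 ≡ + 2 ℤ.* (m ℤ.- + v ℤ.+ + 1)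
      exponent m v = ≡.trans (≡.cong (λ w → + 2 ℤ.* m ℤ.- w ℤ.+ + 2) (ℤP.pos-* 2 v)) (double-distrib m (+ v))

  module QBinomial (q qi : Carrier) (q*qi≈1 : q * qi ≈ 1#) (inv : ℕ → Carrier)
                   (inv-inverse : ∀ n → (1# - pow R q (suc n)) * inv n ≈ 1#) where
    open IntegerPowers q qi q*qi≈1

    private
      Z : ℤ → Carrier
      Z = zpow R q qi
      qbinom : ℤ → ℕ → Carrier
      qbinom = qbin R q qi inv

    poch-q-inverse : ∀ n → poch R q q n * pochInv R inv n ≈ 1#
    poch-q-inverse n = trans (sym (prod-distrib-* n _ inv)) (prod-≈1 n inv-inverse)

    poch-q²≈poch-q*poch-−q : ∀ n → poch R (q * q) (q * q) n ≈ poch R q q n * poch R (- q) q n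
    poch-q²≈poch-q*poch-−q n = trans (prod-cong n factor) (prod-distrib-* n _ _)
      where
      factor : ∀ j → 1# - (q * q) * pow R (q * q) j ≈ (1# - q * pow R q j) * (1# - (- q) * pow R q j)
      factor j = begin
        1# - (q * q) * pow R (q * q) j           ≈⟨ +-congˡ (-‿cong (*-congˡ (pow-distrib-* q q j))) ⟩
        1# - (q * q) * (pow R q j * pow R q j)   ≈⟨ +-congˡ (-‿cong (interchange q q _ _)) ⟩
        1# - a * a                               ≈⟨ [1-x][1+x]≈1-x² a ⟨
        (1# - a) * (1# - - a)                    ≈⟨ *-congˡ (+-congˡ (-‿cong (-‿distribˡ-* q _))) ⟩
        (1# - a) * (1# - (- q) * pow R q j)      ∎
        where
        a : Carrier
        a = q * pow R q j

    poch-q²*pochInv≈poch-−q : ∀ n → poch R (q * q) (q * q) n * pochInv R inv n ≈ poch R (- q) q n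
    poch-q²*pochInv≈poch-−q n = begin
      poch R (q * q) (q * q) n * pochInv R inv n                ≈⟨ *-congʳ (poch-q²≈poch-q*poch-−q n) ⟩
      (poch R q q n * poch R (- q) q n) * pochInv R inv n       ≈⟨ xy∙z≈y∙xz _ _ _ ⟩
      poch R (- q) q n * (poch R q q n * pochInv R inv n)       ≈⟨ *-congˡ (poch-q-inverse n) ⟩
      poch R (- q) q n * 1#                                     ≈⟨ *-identityʳ _ ⟩
      poch R (- q) q n                                          ∎

    qbin-zero-suc : ∀ k → qbinom (+ 0) (suc k) ≈ 0#
    qbin-zero-suc k = begin
      (poch R (Z e) q k * (1# - Z e * pow R q k)) * I  ≈⟨ *-congʳ (*-congˡ (+-congˡ (-‿cong Ze*qᵏ≈1))) ⟩
      (poch R (Z e) q k * (1# - 1#)) * I              ≈⟨ *-congʳ (*-congˡ (-‿inverseʳ 1#)) ⟩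
      (poch R (Z e) q k * 0#) * I                     ≈⟨ *-congʳ (zeroʳ _) ⟩
      0# * I                                          ≈⟨ zeroˡ I ⟩
      0#                                              ∎
      where
      e : ℤ
      e = + 0 ℤ.- + suc k ℤ.+ + 1
      I : Carrier
      I = pochInv R inv (suc k)
      0-[1+k]+1+k≡0 : ∀ k → (+ 0 ℤ.- (+ 1 ℤ.+ k) ℤ.+ + 1) ℤ.+ k ≡ + 0
      0-[1+k]+1+k≡0 = solve-∀
      Ze*qᵏ≈1 : Z e * pow R q k ≈ 1#
      Ze*qᵏ≈1 = trans (zpow-homo-* e (+ k)) (reflexive (≡.cong Z (0-[1+k]+1+k≡0 (+ k))))

    qbin-pascal : ∀ n k → qbinom (n ℤ.+ + 1) (suc k) ≈ qbinom n (suc k) + Z (n ℤ.- + k) * qbinom n k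
    qbin-pascal n k = begin
      qbinom (n ℤ.+ + 1) (suc k)
        ≡⟨ ≡.cong (λ e → poch R (Z e) q (suc k) * pochInv R inv (suc k)) ([n+1]-[1+k]+1≡n-k+1 n (+ k)) ⟩
      (P * (1# - Z e₀ * pow R q k)) * (I * J)
        ≈⟨ *-congʳ (*-congˡ (+-congˡ (-‿cong last≈uQ))) ⟩
      (P * (1# - u * Q)) * (I * J)
        ≈⟨ solve 4 (λ P s I J → (P :* s) :* (I :* J) := (P :* I) :* (s :* J)) refl P (1# - u * Q) I J ⟩
      (P * I) * ((1# - u * Q) * J)
        ≈⟨ *-congˡ ([1-xy]z≈[1-x]z+x u Q J (inv-inverse k)) ⟩
      (P * I) * ((1# - u) * J + u)
        ≈⟨ solve 5 (λ P I t J u → (P :* I) :* (t :* J :+ u) := (t :* P) :* (I :* J) :+ u :* (P :* I))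
                   refl P I (1# - u) J u ⟩
      ((1# - u) * P) * (I * J) + u * (P * I)
        ≈⟨ +-congʳ (*-congʳ head≈[1-u]P) ⟨
      qbinom n (suc k) + u * qbinom n k ∎
      where
      e₀ e₂ : ℤ
      e₀ = n ℤ.- + k ℤ.+ + 1
      e₂ = n ℤ.- + suc k ℤ.+ + 1
      u P Q I J : Carrier
      u = Z (n ℤ.- + k)
      P = poch R (Z e₀) q k
      Q = pow R q (suc k)
      I = pochInv R inv k
      J = inv k
      [n+1]-[1+k]+1≡n-k+1 : ∀ n k → (n ℤ.+ + 1) ℤ.- (+ 1 ℤ.+ k) ℤ.+ + 1 ≡ n ℤ.- k ℤ.+ + 1
      [n+1]-[1+k]+1≡n-k+1 = solve-∀
      n-[1+k]+1≡n-k : ∀ n k → n ℤ.- (+ 1 ℤ.+ k) ℤ.+ + 1 ≡ n ℤ.- k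
      n-[1+k]+1≡n-k = solve-∀
      last≈uQ : Z e₀ * pow R q k ≈ u * Q
      last≈uQ = trans (*-congʳ (zpow-suc (n ℤ.- + k))) (*-assoc u q _)
      head≈[1-u]P : poch R (Z e₂) q (suc k) ≈ (1# - u) * P
      head≈[1-u]P = begin
        poch R (Z e₂) q (suc k)        ≡⟨ ≡.cong (λ e → poch R (Z e) q (suc k)) (n-[1+k]+1≡n-k n (+ k)) ⟩
        poch R u q (suc k)             ≈⟨ poch-suc-head u q k ⟩
        (1# - u) * poch R (u * q) q k  ≈⟨ *-congˡ (poch-congˡ q k (zpow-suc (n ℤ.- + k))) ⟨
        (1# - u) * P                   ∎

    module _ (y : Carrier) where

      -- With x = -q y the factor (-x)^k q^(T_k - k) becomes y^k q^(T_k).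
      private
        x : Carrier
        x = - (q * y)

      cpochCoeff : ℤ → ℕ → Carrier
      cpochCoeff n k = pow R y k * pow R q (T k) * qbinom n k

      cpochCoeff-zero : ∀ n → cpochCoeff n 0 ≈ 1#
      cpochCoeff-zero n = trans (*-cong (*-identityˡ 1#) (*-identityˡ 1#)) (*-identityˡ 1#)

      cpochCoeff-pascal : ∀ n k →
        cpochCoeff n (suc k) ≈ cpochCoeff (n ℤ.+ + 1) (suc k) + (x * Z n) * cpochCoeff n k
      cpochCoeff-pascal n k = begin
        Y * b₁                                         ≈⟨ //-rightDividesʳ t (Y * b₁) ⟨
        (Y * b₁ + t) - t                               ≈⟨ +-cong Y*pascal (sym xZn*coeff≈-t) ⟩
        Y * qbinom (n ℤ.+ + 1) (suc k) + (x * Z n) * cpochCoeff n k ∎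
        where
        u b₀ b₁ Y t : Carrier
        u  = Z (n ℤ.- + k)
        b₀ = qbinom n k
        b₁ = qbinom n (suc k)
        Y  = pow R y (suc k) * pow R q (T (suc k))
        t  = Y * (u * b₀)
        n-k+k≡n : ∀ n k → n ℤ.- k ℤ.+ k ≡ n
        n-k+k≡n = solve-∀
        Zn≈uqᵏ : Z n ≈ u * pow R q k
        Zn≈uqᵏ = trans (reflexive (≡.cong Z (≡.sym (n-k+k≡n n (+ k))))) (sym (zpow-homo-* (n ℤ.- + k) (+ k)))
        Y*pascal : Y * b₁ + t ≈ Y * qbinom (n ℤ.+ + 1) (suc k)
        Y*pascal = sym (trans (*-congˡ (qbin-pascal n k)) (distribˡ Y b₁ (u * b₀)))
        xZn*coeff≈-t : (x * Z n) * cpochCoeff n k ≈ - t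
        xZn*coeff≈-t = begin
          (- (q * y) * Z n) * cpochCoeff n k           ≈⟨ *-congʳ (-‿distribˡ-* (q * y) (Z n)) ⟨
          - (q * y * Z n) * cpochCoeff n k             ≈⟨ -‿distribˡ-* _ _ ⟨
          - ((q * y * Z n) * cpochCoeff n k)           ≈⟨ -‿cong (*-congʳ (*-congˡ Zn≈uqᵏ)) ⟩
          - ((q * y * (u * pow R q k)) * (pow R y k * pow R q (T k) * b₀))
            ≈⟨ -‿cong (solve 7 (λ q y u Qk Yk Tk b → (q :* y :* (u :* Qk)) :* (Yk :* Tk :* b)
                                                     := (y :* Yk) :* ((q :* Qk) :* Tk) :* (u :* b))
                                 refl q y u (pow R q k) (pow R y k) (pow R q (T k)) b₀) ⟩
          - ((y * pow R y k) * ((q * pow R q k) * pow R q (T k)) * (u * b₀))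
            ≈⟨ -‿cong (*-congʳ (*-congˡ (pow-homo-* q (suc k) (T k)))) ⟨
          - t                                          ∎

      ⊛-linS-cpochCoeff : ∀ n {g : Series R} → (∀ k → g k ≈ cpochCoeff n k) →
                          ∀ k → _⊛_ R g (linS R (x * Z n)) k ≈ cpochCoeff (n ℤ.+ + 1) k
      ⊛-linS-cpochCoeff n {g} g≈ zero =
        trans (trans (⊛-zero g (linS R (x * Z n))) (*-identityʳ (g 0)))
              (trans (g≈ 0) (trans (cpochCoeff-zero n) (sym (cpochCoeff-zero (n ℤ.+ + 1)))))
      ⊛-linS-cpochCoeff n {g} g≈ (suc k) = begin
        _⊛_ R g (linS R (x * Z n)) (suc k)                    ≈⟨ ⊛-linS-suc g (x * Z n) k ⟩
        g (suc k) - (x * Z n) * g k                           ≈⟨ +-cong (g≈ (suc k)) (-‿cong (*-congˡ (g≈ k))) ⟩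
        cpochCoeff n (suc k) - (x * Z n) * cpochCoeff n k     ≈⟨ +-congʳ (cpochCoeff-pascal n k) ⟩
        (cpochCoeff (n ℤ.+ + 1) (suc k) + w) - w              ≈⟨ //-rightDividesʳ w _ ⟩
        cpochCoeff (n ℤ.+ + 1) (suc k)                        ∎
        where
        w : Carrier
        w = (x * Z n) * cpochCoeff n k

      ⊛-geomS-cpochCoeff : ∀ n {g : Series R} → (∀ k → g k ≈ cpochCoeff (n ℤ.+ + 1) k) →
                           ∀ k → _⊛_ R g (geomS R (x * Z n)) k ≈ cpochCoeff n k
      ⊛-geomS-cpochCoeff n {g} g≈ zero =
        trans (trans (⊛-zero g (geomS R (x * Z n))) (*-identityʳ (g 0)))
              (trans (g≈ 0) (trans (cpochCoeff-zero (n ℤ.+ + 1)) (sym (cpochCoeff-zero n))))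
      ⊛-geomS-cpochCoeff n {g} g≈ (suc k) = begin
        _⊛_ R g (geomS R (x * Z n)) (suc k)
          ≈⟨ ⊛-geomS-suc g (x * Z n) k ⟩
        g (suc k) + (x * Z n) * _⊛_ R g (geomS R (x * Z n)) k
          ≈⟨ +-cong (g≈ (suc k)) (*-congˡ (⊛-geomS-cpochCoeff n g≈ k)) ⟩
        cpochCoeff (n ℤ.+ + 1) (suc k) + (x * Z n) * cpochCoeff n k
          ≈⟨ cpochCoeff-pascal n k ⟨
        cpochCoeff n (suc k) ∎

      cpoch-qBinomial : ∀ n k → cpoch R x q qi n k ≈ cpochCoeff n k
      cpoch-qBinomial (+ n)    = nonneg n
        where
        nonneg : ∀ n k → cpoch R x q qi (+ n) k ≈ cpochCoeff (+ n) k
        nonneg zero    zero    = sym (cpochCoeff-zero (+ 0))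
        nonneg zero    (suc k) = sym (trans (*-congˡ (qbin-zero-suc k)) (zeroʳ _))
        nonneg (suc n) k       = trans (⊛-linS-cpochCoeff (+ n) (nonneg n) k)
                                       (reflexive (≡.cong (λ m → cpochCoeff (+ m) k) (ℕP.+-comm n 1)))
      cpoch-qBinomial -[1+ m ] = neg m
        where
        neg : ∀ m k → cpoch R x q qi -[1+ m ] k ≈ cpochCoeff -[1+ m ] k
        neg zero    = ⊛-geomS-cpochCoeff -[1+ 0 ] (cpoch-qBinomial (+ 0))
        neg (suc m) = ⊛-geomS-cpochCoeff -[1+ suc m ] (neg m)

mainTheorem13 : ∀ {c ℓ} (R : CommutativeRing c ℓ) →
    let open CommutativeRing R in
    (q qi : Carrier) → q * qi ≈ 1# →
    (inv : ℕ → Carrier) → (∀ n → _−_ R 1# (pow R q (suc n)) * inv n ≈ 1#) →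
    (r : ℕ) → 1 ≤ r → (M : Fin r → ℤ) (L : ℤ) →
    (ν : Fin r → ℕ) (k : ℕ) →
    Thm13.lhsCoeff R q qi inv M L ν k ≈ Thm13.rhsSeries R q qi inv M L ν k
mainTheorem13 R q qi q*qi≈1 inv inv-inverse r _ M L ν k = begin
  pow R q (2 ℕ.* S ℕ.+ T k ℕ.+ k ℕ.* N) * PP * INk * (P2 * Pι) * (QNk * IN * Ik) * PZ
    ≈⟨ *-congʳ (*-congʳ (*-congʳ (*-congʳ (*-congʳ exponent-split)))) ⟩
  A * Tk * Yk * PP * INk * (P2 * Pι) * (QNk * IN * Ik) * PZ
    ≈⟨ solve 11 (λ A Tk Yk PP INk P2 Pι QNk IN Ik PZ →
                   A :* Tk :* Yk :* PP :* INk :* (P2 :* Pι) :* (QNk :* IN :* Ik) :* PZ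
                   := A :* (PZ :* Pι) :* (P2 :* IN) :* (Yk :* Tk :* (PP :* Ik)) :* (QNk :* INk))
                refl A Tk Yk PP INk P2 Pι QNk IN Ik PZ ⟩
  A * (PZ * Pι) * (P2 * IN) * (Yk * Tk * (PP * Ik)) * (QNk * INk)
    ≈⟨ *-cong (*-cong (*-cong (*-congˡ q²-binomials) (poch-q²*pochInv≈poch-−q N))
                      (sym (cpoch-qBinomial (pow R q N) (L ℤ.- + N) k)))
              (poch-q-inverse (N ℕ.+ k)) ⟩
  Thm13.rhsSeries R q qi inv M L ν k * 1#
    ≈⟨ *-identityʳ _ ⟩
  Thm13.rhsSeries R q qi inv M L ν k ∎
  where
  open CommutativeRing R
  open SetoidReasoning setoid
  open NaturalCoefficientsSolver commutativeSemiring using (solve; _:=_; _:*_)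
  open QBinomial R q qi q*qi≈1 inv inv-inverse
  open IntegerPowers R q qi q*qi≈1 using (qbin-square)
  open Thm13 R q qi inv M L using (ι2)

  N S : ℕ
  N = sumFin ν
  S = sumFin (λ i → T (ν i))
  poch-ν : Fin r → Carrier
  poch-ν i = poch R (zpow R q qi (+ 2 ℤ.* M i ℤ.- + (2 ℕ.* ν i) ℤ.+ + 2)) (q * q) (ν i)
  A Tk Yk PP INk P2 Pι QNk IN Ik PZ : Carrier
  A   = pow R q (2 ℕ.* S)
  Tk  = pow R q (T k)
  Yk  = pow R (pow R q N) k
  PP  = poch R (zpow R q qi (L ℤ.- + N ℤ.- + k ℤ.+ + 1)) q k
  INk = pochInv R inv (N ℕ.+ k)
  P2  = poch R (q * q) (q * q) N
  Pι  = prodFin R (λ i → pochInv R ι2 (ν i))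
  QNk = poch R q q (N ℕ.+ k)
  IN  = pochInv R inv N
  Ik  = pochInv R inv k
  PZ  = prodFin R poch-ν

  exponent-split : pow R q (2 ℕ.* S ℕ.+ T k ℕ.+ k ℕ.* N) ≈ A * Tk * Yk
  exponent-split = trans (pow-homo-* R q (2 ℕ.* S ℕ.+ T k) (k ℕ.* N))
                         (*-cong (pow-homo-* R q (2 ℕ.* S) (T k)) (sym (pow-assocʳ R q N k)))

  q²-binomials : PZ * Pι ≈ prodFin R (λ i → qbin R (q * q) (qi * qi) ι2 (M i) (ν i))
  q²-binomials = trans (sym (prodFin-distrib-* R poch-ν (λ i → pochInv R ι2 (ν i))))
                       (prodFin-cong R (λ i → sym (qbin-square ι2 (M i) (ν i))))
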